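{- For every positive integer $k$ there exists a connected graph $G$ with $\ell(G)-\mathrm{vv}(G)\ge k$; that is, the difference between $\ell(G)$ and $\mathrm{vv}(G)$ can be arbitrarily large.
   Context: All graphs are finite and simple. $\ell(G)$ denotes the maximum number of leaves (vertices of degree $1$) in a spanning tree of $G$. For a vertex $x$ of a connected graph $G$, a set $S\subseteq V(G)\setminus\{x\}$ is an $x$-visibility set if for every $y\in S$ there exists a shortest $x,y$-path $P$ with $V(P)\cap S=\{y\}$; $v_x(G)$ is the maximum size of an $x$-visibility set and $\mathrm{vv}(G)=\max_{x\in V(G)} v_x(G)$. -}

module Defs where

open import Data.Nat using (ℕ; _≤_; _+_; _∸_)
open import Data.Bool using (Bool; true; false)
open import Data.Fin using (Fin)
open import Data.Fin.Subset using (Subset; _∈_; _∉_; ∣_∣)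
open import Data.List using (List; []; _∷_; _++_; [_]; length; filterᵇ; last)
open import Data.List.Relation.Unary.Linked using (Linked)
open import Data.List.Relation.Unary.Unique.Propositional using (Unique)
open import Data.List.Relation.Unary.All using (All)
open import Data.List.Membership.Propositional using () renaming (_∈_ to _∈L_)
open import Data.List using (allFin)
open import Data.Maybe using (just)
open import Data.Product using (Σ; _×_; ∃; ∃-syntax; _,_)
open import Relation.Binary.PropositionalEquality using (_≡_; _≢_)
open import Relation.Nullary using (¬_)

record Graph (n : ℕ) : Set where
  field
    adj     : Fin n → Fin n → Bool
    adj-sym : ∀ u v → adj u v ≡ adj v u
    irrefl  : ∀ v → adj v v ≡ false
open Graph public

Adj : ∀ {n} → Graph n → Fin n → Fin n → Set
Adj G u v = adj G u v ≡ true

IsPath : ∀ {n} → Graph n → Fin n → Fin n → List (Fin n) → Set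
IsPath G x y [] = Data.Empty.⊥ where import Data.Empty
IsPath G x y (v ∷ vs) =
  (v ≡ x) × (last (v ∷ vs) ≡ just y) × Linked (Adj G) (v ∷ vs) × Unique (v ∷ vs)

pathLength : ∀ {A : Set} → List A → ℕ
pathLength vs = length vs ∸ 1

IsShortestPath : ∀ {n} → Graph n → Fin n → Fin n → List (Fin n) → Set
IsShortestPath G x y P =
  IsPath G x y P × (∀ Q → IsPath G x y Q → pathLength P ≤ pathLength Q)

Connected : ∀ {n} → Graph n → Set
Connected {n} G = ∀ (x y : Fin n) → ∃[ P ] IsPath G x y P

IsCycle : ∀ {n} → Graph n → List (Fin n) → Set
IsCycle G [] = Data.Empty.⊥ where import Data.Empty
IsCycle G (v ∷ vs) =
  (2 ≤ length vs) × Unique (v ∷ vs) × Linked (Adj G) ((v ∷ vs) ++ [ v ])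

Acyclic : ∀ {n} → Graph n → Set
Acyclic G = ∀ C → ¬ IsCycle G C

Subgraph : ∀ {n} → Graph n → Graph n → Set
Subgraph {n} T G = ∀ (u v : Fin n) → Adj T u v → Adj G u v

SpanningTree : ∀ {n} → Graph n → Graph n → Set
SpanningTree T G = Subgraph T G × Connected T × Acyclic T

degree : ∀ {n} → Graph n → Fin n → ℕ
degree {n} G v = length (filterᵇ (adj G v) (allFin n))

leaves : ∀ {n} → Graph n → ℕ
leaves {n} G = length (filterᵇ isLeaf (allFin n))
  where
  isLeaf : Fin n → Bool
  isLeaf v with degree G v
  ... | 1 = true
  ... | _ = false

IsVisibilitySet : ∀ {n} → Graph n → Fin n → Subset n → Set
IsVisibilitySet {n} G x S =
  x ∉ S ×
  (∀ (y : Fin n) → y ∈ S →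
     ∃[ P ] (IsShortestPath G x y P ×
             (∀ (z : Fin n) → z ∈L P → z ∈ S → z ≡ y)))

-- Glue m = k + 4 copies of a block at a common root: the block is the 5-cycle 0–1–2–3–4–0
-- through the root 0 with a pendant vertex 5 at 3. Omitting the edge 1–2 from every copy
-- leaves a spanning tree in which 1, 2 and 5 are leaves of each copy, so ℓ ≥ 3m. A copy not containing x is entered through the root, and
-- there every shortest path to 2 passes through 1, to 3 through 4, and to 5 through 3 and 4.
-- As only its target may lie in S, S meets such a copy in at most two vertices, whence
-- |S| ≤ 1 + 5 + 2(m − 1) = 2m + 4 = 3m − k.
module Submission where

open import Defs
open import Data.Nat using (ℕ; _≤_; _+_; NonZero)
open import Data.Fin using (Fin)
open import Data.Fin.Subset using (Subset; ∣_∣)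
open import Data.Product using (Σ; _×_; ∃; ∃-syntax)

open import Data.Bool using (Bool; true; false; _∧_; _∨_; if_then_else_)
import Data.Bool.Properties as Bool
open import Data.Empty using (⊥-elim)
open import Data.Fin using (zero; suc; combine; quotient; remainder; _↑ˡ_; _↑ʳ_; _≟_)
open import Data.Fin.Patterns using (0F; 1F; 2F; 3F; 4F; 5F)
import Data.Fin.Properties as Fin
open import Data.Fin.Properties using (all?; any?; remQuot-combine; combine-remQuot; combine-injective)
open import Data.Fin.Subset using () renaming (_∈_ to _∈ₛ_; _∉_ to _∉ₛ_)
open import Data.Fin.Subset.Properties using (anySubset?) renaming (_∈?_ to _∈ₛ?_)
open import Data.List as List using (List; []; _∷_; _++_; [_]; last; filterᵇ; allFin)
open import Data.List.Extrema.Nat using (argmax; argmax-sel; f[⊥]≤f[argmax]; f[xs]≤f[argmax])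
open import Data.List.Membership.Propositional using (_∈_; _∉_)
open import Data.List.Membership.Propositional.Properties using (∈-∃++; ∈-++⁺ˡ; ∈-++⁺ʳ)
open import Data.List.Properties using (++-assoc)
open import Data.List.Relation.Unary.All as All using ([])
open import Data.List.Relation.Unary.AllPairs using ([]; _∷_)
open import Data.List.Relation.Unary.Any using (here; there)
open import Data.List.Relation.Unary.Linked as Linked using (Linked; []; [-]; _∷_)
open import Data.List.Relation.Unary.Unique.Propositional using (Unique)
open import Data.Maybe using (just)
open import Data.Nat using (zero; suc; _*_; _∸_; _<_; _≡ᵇ_; z≤n; s≤s)
open import Data.Nat.Induction using (<-wellFounded)
import Data.Nat.Properties as ℕ
open import Data.Nat.Properties
  using ( ≤-refl; ≤-trans; ≤-reflexive; ≤-antisym; <-trans; <-irrefl; n≤1+n; m≤n+m; _≤?_; _<?_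
        ; +-suc; +-assoc; +-comm; +-identityʳ; +-mono-≤; +-monoˡ-≤; +-monoʳ-≤; +-cancelʳ-≤; +-cancelˡ-≡
        ; +-0-commutativeMonoid; module ≤-Reasoning )
open import Data.Nat.Tactic.RingSolver using (solve-∀)
open import Data.Product using (Σ-syntax; ∃₂; _,_; proj₁; proj₂; uncurry)
open import Data.Product.Properties using (≡-dec)
open import Data.Sum using (_⊎_; inj₁; inj₂; [_,_]′)
open import Data.Vec using (Vec; []; _∷_; lookup; tabulate)
open import Data.Vec.Base using (there)
open import Data.Vec.Properties using (lookup∘tabulate; lookup⇒[]=; []=⇒lookup)
open import Function using (mk⇔)
open import Induction.WellFounded using (Acc; acc)
open import Relation.Nullary using (Dec; yes; no; does; ¬?)
open import Relation.Nullary.Decidable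
  using (from-yes; from-no; decidable-stable; dec-true; dec-false; does-⇔; _→-dec_; _×-dec_)
open import Relation.Binary.PropositionalEquality
  using (_≡_; _≢_; refl; sym; trans; cong; cong₂; subst; subst₂; module ≡-Reasoning)

open import Algebra.Properties.CommutativeMonoid.Sum +-0-commutativeMonoid using (sum; sum-syntax; sum-cong-≗)

module _ {A : Set} where

  last⁺ : A → List A → A
  last⁺ x [] = x
  last⁺ x (y ∷ ys) = last⁺ y ys

  last⁺∈ : ∀ x xs → last⁺ x xs ∈ x ∷ xs
  last⁺∈ x [] = here refl
  last⁺∈ x (y ∷ ys) = there (last⁺∈ y ys)

  last⇒∈ : ∀ xs {y : A} → last xs ≡ just y → y ∈ xs
  last⇒∈ (x ∷ []) refl = here refl
  last⇒∈ (x ∷ x′ ∷ xs) eq = there (last⇒∈ (x′ ∷ xs) eq)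

  maximal-element : (f : A → ℕ) → ∀ x xs → ∃[ z ] (z ∈ x ∷ xs × ∀ {y} → y ∈ x ∷ xs → f y ≤ f z)
  maximal-element f x xs = argmax f x xs , [ here , there ]′ (argmax-sel f x xs) , bound
    where
    bound : ∀ {y} → y ∈ x ∷ xs → f y ≤ f (argmax f x xs)
    bound (here refl) = f[⊥]≤f[argmax] {f = f} x xs
    bound (there y∈) = All.lookup (f[xs]≤f[argmax] x xs) y∈

  unique-++⇒disjoint : ∀ xs {ys : List A} → Unique (xs ++ ys) → ∀ {a b} → a ∈ xs → b ∈ ys → a ≢ b
  unique-++⇒disjoint (x ∷ xs) (x∉ ∷ _) (here refl) b∈ = All.lookup x∉ (∈-++⁺ʳ xs b∈)
  unique-++⇒disjoint (x ∷ xs) (_ ∷ unique) (there a∈) b∈ = unique-++⇒disjoint xs unique a∈ b∈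

  module _ {R : A → A → Set} where

    linked-before : ∀ x xs {z ys} → Linked R (x ∷ xs ++ z ∷ ys) → R (last⁺ x xs) z
    linked-before x [] (r ∷ _) = r
    linked-before x (y ∷ xs) (_ ∷ linked) = linked-before y xs linked

    linked-after : ∀ xs {z a ys} → Linked R (xs ++ z ∷ a ∷ ys) → R z a
    linked-after [] (r ∷ _) = r
    linked-after (x ∷ []) (_ ∷ r ∷ _) = r
    linked-after (x ∷ y ∷ xs) (_ ∷ linked) = linked-after (y ∷ xs) linked

-- Walks and paths

infixr 5 _◅_

data Walk {n} (G : Graph n) : Fin n → Fin n → Set where
  ε : ∀ {u} → Walk G u u
  _◅_ : ∀ {u v w} → Adj G u v → Walk G v w → Walk G u w

Lipschitz : ∀ {n} → Graph n → (Fin n → ℕ) → Set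
Lipschitz G φ = ∀ {u v} → Adj G u v → φ v ≤ suc (φ u)

module _ {n} {G : Graph n} where

  open import Data.List.Membership.DecPropositional (_≟_ {n}) using (_∈?_)

  Adj-sym : ∀ {u v} → Adj G u v → Adj G v u
  Adj-sym {u} {v} e = trans (adj-sym G v u) e

  infixr 5 _◅◅_

  _◅◅_ : ∀ {u v t} → Walk G u v → Walk G v t → Walk G u t
  ε ◅◅ w′ = w′
  (e ◅ w) ◅◅ w′ = e ◅ (w ◅◅ w′)

  reverse : ∀ {u v} → Walk G u v → Walk G v u
  reverse ε = ε
  reverse (e ◅ w) = reverse w ◅◅ (Adj-sym e ◅ ε)

  steps : ∀ {u v} → Walk G u v → ℕ
  steps ε = 0
  steps (_ ◅ w) = suc (steps w)

  vertices : ∀ {u v} → Walk G u v → List (Fin n)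
  vertices {u} ε = u ∷ []
  vertices {u} (_ ◅ w) = u ∷ vertices w

  length-vertices : ∀ {u v} (w : Walk G u v) → List.length (vertices w) ≡ suc (steps w)
  length-vertices ε = refl
  length-vertices (_ ◅ w) = cong suc (length-vertices w)

  steps-◅◅ : ∀ {u v t} (w : Walk G u v) (w′ : Walk G v t) → steps (w ◅◅ w′) ≡ steps w + steps w′
  steps-◅◅ ε w′ = refl
  steps-◅◅ (_ ◅ w) w′ = cong suc (steps-◅◅ w w′)

  path-suffix : ∀ {v x y} P → IsPath G v y P → x ∈ P →
    ∃[ Q ] (IsPath G x y Q × pathLength Q ≤ pathLength P)
  path-suffix (u ∷ us) (refl , path) (here refl) = u ∷ us , (refl , path) , ≤-refl
  path-suffix (u ∷ u′ ∷ us) (refl , last≡ , _ ∷ linked , _ ∷ unique) (there x∈) =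
    let Q , isQ , Q≤ = path-suffix (u′ ∷ us) (refl , last≡ , linked , unique) x∈
    in Q , isQ , ≤-trans Q≤ (n≤1+n _)

  walk⇒path : ∀ {x y} (w : Walk G x y) → ∃[ P ] (IsPath G x y P × pathLength P ≤ steps w)
  walk⇒path {x} ε = x ∷ [] , (refl , refl , [-] , [] ∷ []) , z≤n
  walk⇒path {x} (e ◅ w) with walk⇒path w
  ... | v ∷ vs , (refl , last≡ , linked , unique) , P≤ with x ∈? v ∷ vs
  ...   | no x∉ =
    x ∷ v ∷ vs ,
    (refl , last≡ , e ∷ linked , All.tabulate (λ x∈ x≡ → x∉ (subst (_∈ v ∷ vs) (sym x≡) x∈)) ∷ unique) ,
    s≤s P≤
  ...   | yes x∈ =
    let Q , isQ , Q≤ = path-suffix (v ∷ vs) (refl , last≡ , linked , unique) x∈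
    in Q , isQ , ≤-trans Q≤ (≤-trans P≤ (n≤1+n _))

  path⇒walk : ∀ {x y P} → IsPath G x y P → Σ[ w ∈ Walk G x y ] vertices w ≡ P
  path⇒walk {P = v ∷ []} (refl , refl , _ , _) = ε , refl
  path⇒walk {P = v ∷ u ∷ vs} (refl , last≡ , e ∷ linked , _ ∷ unique) =
    let w , w≡ = path⇒walk (refl , last≡ , linked , unique) in e ◅ w , cong (v ∷_) w≡

  path-target∈ : ∀ {x y P} → IsPath G x y P → y ∈ P
  path-target∈ {P = v ∷ vs} (_ , last≡ , _) = last⇒∈ (v ∷ vs) last≡

  subgraph-path : ∀ {T : Graph n} → Subgraph T G → ∀ {x y P} → IsPath T x y P → IsPath G x y P
  subgraph-path T⊆G {P = v ∷ vs} (head≡ , last≡ , linked , unique) =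
    head≡ , last≡ , Linked.map (T⊆G _ _) linked , unique

  subgraph-connected : ∀ {T : Graph n} → Subgraph T G → Connected T → Connected G
  subgraph-connected T⊆G T-connected x y = let P , isP = T-connected x y in P , subgraph-path T⊆G isP

  module _ {φ : Fin n → ℕ} (φ-lipschitz : Lipschitz G φ) where

    lipschitz-walk : ∀ {u v} (w : Walk G u v) → φ v ≤ φ u + steps w
    lipschitz-walk {u} ε = ≤-reflexive (sym (+-identityʳ (φ u)))
    lipschitz-walk {u} (e ◅ w) = begin
      φ _                 ≤⟨ lipschitz-walk w ⟩
      φ _ + steps w       ≤⟨ +-monoˡ-≤ (steps w) (φ-lipschitz e) ⟩
      suc (φ u) + steps w ≡⟨ sym (+-suc (φ u) (steps w)) ⟩
      φ u + steps (e ◅ w) ∎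
      where open ≤-Reasoning

    module _ {u u′ v} (e : Adj G u u′) (w : Walk G u′ v) (tight : φ u + steps (e ◅ w) ≤ φ v) where

      tight-head : suc (φ u) ≡ φ u′
      tight-head = ≤-antisym
        (+-cancelʳ-≤ (steps w) (suc (φ u)) (φ u′)
          (≤-trans (≤-reflexive (sym (+-suc (φ u) (steps w)))) (≤-trans tight (lipschitz-walk w))))
        (φ-lipschitz e)

      tight-tail : φ u′ + steps w ≤ φ v
      tight-tail = ≤-trans (+-monoˡ-≤ (steps w) (φ-lipschitz e))
        (≤-trans (≤-reflexive (sym (+-suc (φ u) (steps w)))) tight)

    tight-predecessor : ∀ {u v} (w : Walk G u v) → φ u + steps w ≤ φ v →
      ∀ {z} → z ∈ vertices w → z ≢ u → ∃[ z′ ] (z′ ∈ vertices w × Adj G z′ z × suc (φ z′) ≡ φ z)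
    tight-predecessor ε _ (here z≡u) z≢u = ⊥-elim (z≢u z≡u)
    tight-predecessor (e ◅ w) _ (here z≡u) z≢u = ⊥-elim (z≢u z≡u)
    tight-predecessor {u} (_◅_ {v = u′} e w) tight {z} (there z∈) _ with z ≟ u′
    ... | yes refl = u , here refl , e , tight-head e w tight
    ... | no z≢u′ =
      let z′ , z′∈ , e′ , φ≡ = tight-predecessor w (tight-tail e w tight) z∈ z≢u′
      in z′ , there z′∈ , e′ , φ≡

  cycle-neighbours : ∀ {C} → IsCycle G C → ∀ {z} → z ∈ C →
    ∃₂ λ a b → a ∈ C × b ∈ C × a ≢ b × Adj G z a × Adj G z b
  cycle-neighbours {v ∷ []} (() , _)
  cycle-neighbours {v ∷ _ ∷ []} (s≤s () , _)
  cycle-neighbours {v ∷ a ∷ a′ ∷ as} (_ , (_ ∷ a∉ ∷ _) , e ∷ closed) (here refl) =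
    a , last⁺ a′ as , there (here refl) , there (there (last⁺∈ a′ as)) ,
    All.lookup a∉ (last⁺∈ a′ as) , e , Adj-sym (linked-before v (a ∷ a′ ∷ as) (e ∷ closed))
  cycle-neighbours {v ∷ vs} cycle (there z∈) with ∈-∃++ z∈
  cycle-neighbours {v ∷ .(pre ++ z ∷ suf)} cycle {z} (there z∈) | pre , suf , refl = inside pre suf cycle
    where
    reassociate : ∀ pre suf → Linked (Adj G) ((v ∷ pre ++ z ∷ suf) ++ [ v ]) →
      Linked (Adj G) (v ∷ pre ++ z ∷ (suf ++ [ v ]))
    reassociate pre suf = subst (λ l → Linked (Adj G) (v ∷ l)) (++-assoc pre (z ∷ suf) [ v ])

    inside : ∀ pre suf → IsCycle G (v ∷ pre ++ z ∷ suf) → let C = v ∷ pre ++ z ∷ suf in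
      ∃₂ λ a b → a ∈ C × b ∈ C × a ≢ b × Adj G z a × Adj G z b
    inside [] [] (s≤s () , _)
    inside (p ∷ pre′) [] (_ , v∉ ∷ _ , closed) =
      v , last⁺ p pre′ , here refl , there (∈-++⁺ˡ (last⁺∈ p pre′)) ,
      All.lookup v∉ (∈-++⁺ˡ (last⁺∈ p pre′)) ,
      linked-after (v ∷ p ∷ pre′) (reassociate (p ∷ pre′) [] closed) ,
      Adj-sym (linked-before v (p ∷ pre′) (reassociate (p ∷ pre′) [] closed))
    inside pre (s ∷ suf′) (_ , unique , closed) =
      s , last⁺ v pre , ∈-++⁺ʳ (v ∷ pre) (there (here refl)) , ∈-++⁺ˡ (last⁺∈ v pre) ,
      (λ s≡ → unique-++⇒disjoint (v ∷ pre) unique (last⁺∈ v pre) (there (here refl)) (sym s≡)) ,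
      linked-after (v ∷ pre) (reassociate pre (s ∷ suf′) closed) ,
      Adj-sym (linked-before v pre (reassociate pre (s ∷ suf′) closed))

map-walk : ∀ {n n′} {G : Graph n} {G′ : Graph n′} (f : Fin n → Fin n′) →
  (∀ {u v} → Adj G u v → Adj G′ (f u) (f v)) →
  ∀ {u v} (w : Walk G u v) → Σ[ w′ ∈ Walk G′ (f u) (f v) ] steps w′ ≡ steps w
map-walk f f-adj ε = ε , refl
map-walk f f-adj (e ◅ w) = let w′ , w′≡ = map-walk f f-adj w in f-adj e ◅ w′ , cong suc w′≡

-- A certificate that G is a tree.
record RankedParents {n} (G : Graph n) (root : Fin n) : Set where
  field
    rank : Fin n → ℕ
    parent : Fin n → Fin n
    parent-root : parent root ≡ root
    parent-adj : ∀ u → u ≢ root → Adj G u (parent u)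
    parent-rank : ∀ u → u ≢ root → rank (parent u) < rank u
    lower-is-parent : ∀ {u v} → Adj G u v → rank v ≤ rank u → v ≡ parent u

module _ {n} {G : Graph n} {root : Fin n} (P : RankedParents G root) where
  open RankedParents P

  walk-to-root : ∀ u → Walk G u root
  walk-to-root u = go u (<-wellFounded (rank u))
    where
    go : ∀ u → Acc _<_ (rank u) → Walk G u root
    go u (acc smaller) with u ≟ root
    ... | yes refl = ε
    ... | no u≢root = parent-adj u u≢root ◅ go (parent u) (smaller (parent-rank u u≢root))

  ranked⇒connected : Connected G
  ranked⇒connected x y = let P , isP , _ = walk⇒path (walk-to-root x ◅◅ reverse (walk-to-root y)) in P , isP

  -- A vertex of maximal rank on a cycle would have two distinct neighbours there, both its parent.
  ranked⇒acyclic : Acyclic G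
  ranked⇒acyclic [] ()
  ranked⇒acyclic (v ∷ vs) cycle =
    let z , z∈ , maximal = maximal-element rank v vs
        a , b , a∈ , b∈ , a≢b , za , zb = cycle-neighbours {G = G} cycle z∈
    in a≢b (trans (lower-is-parent za (maximal a∈)) (sym (lower-is-parent zb (maximal b∈))))

  ranked⇒spanning : ∀ {H : Graph n} → Subgraph G H → SpanningTree G H
  ranked⇒spanning G⊆H = G⊆H , ranked⇒connected , ranked⇒acyclic

indicator : Bool → ℕ
indicator true = 1
indicator false = 0

indicator-≤ : ∀ b → indicator b ≤ 1
indicator-≤ true = s≤s z≤n
indicator-≤ false = z≤n

count : ∀ {n} → (Fin n → Bool) → ℕ
count {n} f = ∑[ i < n ] indicator (f i)

count-cong : ∀ {n} {f g : Fin n → Bool} → (∀ i → f i ≡ g i) → count f ≡ count g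
count-cong f≗g = sum-cong-≗ (λ i → cong indicator (f≗g i))

count-≤ : ∀ {n} (f : Fin n → Bool) → count f ≤ n
count-≤ {zero} f = z≤n
count-≤ {suc n} f with f zero
... | true = s≤s (count-≤ (λ i → f (suc i)))
... | false = ≤-trans (count-≤ (λ i → f (suc i))) (n≤1+n n)

length-filter-tabulate : ∀ {A : Set} {n} (f : A → Bool) (g : Fin n → A) →
  List.length (filterᵇ f (List.tabulate g)) ≡ count (λ i → f (g i))
length-filter-tabulate {n = zero} f g = refl
length-filter-tabulate {n = suc n} f g with f (g zero)
... | true = cong suc (length-filter-tabulate f (λ i → g (suc i)))
... | false = length-filter-tabulate f (λ i → g (suc i))

length-filter-allFin : ∀ {n} (f : Fin n → Bool) → List.length (filterᵇ f (allFin n)) ≡ count f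
length-filter-allFin f = length-filter-tabulate f (λ i → i)

∣S∣≡count : ∀ {n} (S : Subset n) → ∣ S ∣ ≡ count (lookup S)
∣S∣≡count [] = refl
∣S∣≡count (true ∷ S) = cong suc (∣S∣≡count S)
∣S∣≡count (false ∷ S) = ∣S∣≡count S

degree≡count : ∀ {n} (G : Graph n) v → degree G v ≡ count (adj G v)
degree≡count G v = length-filter-allFin (adj G v)

-- The leaf test in the definition of leaves is local to it; unification names it.
leaf? : ∀ {n} → Graph n → Fin n → Bool
leaf? {n} G = proj₁ filtered
  where
  filtered : Σ (Fin n → Bool) λ f → leaves G ≡ List.length (filterᵇ f (allFin n))
  filtered = _ , refl

leaf?≗degree≡1 : ∀ {n} (G : Graph n) v → leaf? G v ≡ (degree G v ≡ᵇ 1)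
leaf?≗degree≡1 G v with degree G v
... | zero = refl
... | suc zero = refl
... | suc (suc _) = refl

leaves≡count : ∀ {n} (G : Graph n) → leaves G ≡ count (λ v → degree G v ≡ᵇ 1)
leaves≡count G = trans (length-filter-allFin (leaf? G)) (count-cong (leaf?≗degree≡1 G))

sum-split : ∀ a b (f : Fin (a + b) → ℕ) → sum f ≡ ∑[ i < a ] f (i ↑ˡ b) + ∑[ j < b ] f (a ↑ʳ j)
sum-split zero b f = refl
sum-split (suc a) b f =
  trans (cong (f zero +_) (sum-split a b (λ i → f (suc i)))) (sym (+-assoc (f zero) _ _))

sum-combine : ∀ m h (f : Fin (m * h) → ℕ) → sum f ≡ ∑[ b < m ] ∑[ p < h ] f (combine b p)
sum-combine zero h f = refl
sum-combine (suc m) h f = trans (sum-split h (m * h) f) (cong₂ _+_ refl (sum-combine m h (λ j → f (h ↑ʳ j))))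

sum-zero : ∀ {m} (f : Fin m → ℕ) → (∀ b → f b ≡ 0) → sum f ≡ 0
sum-zero {zero} f zeros = refl
sum-zero {suc m} f zeros = cong₂ _+_ (zeros zero) (sum-zero (λ b → f (suc b)) (λ b → zeros (suc b)))

count-false : ∀ n → count {n} (λ _ → false) ≡ 0
count-false n = sum-zero {n} (λ _ → 0) (λ _ → refl)

sum-single : ∀ {m} (f : Fin m → ℕ) b → (∀ c → c ≢ b → f c ≡ 0) → sum f ≡ f b
sum-single f zero zeros =
  trans (cong (f zero +_) (sum-zero _ (λ c → zeros (suc c) λ ()))) (+-identityʳ _)
sum-single f (suc b) zeros =
  cong₂ _+_ (zeros zero λ ()) (sum-single (λ c → f (suc c)) b (λ c c≢b → zeros (suc c) λ { refl → c≢b refl }))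

sum-const : ∀ m c → ∑[ b < m ] c ≡ m * c
sum-const zero c = refl
sum-const (suc m) c = cong (c +_) (sum-const m c)

sum-≤ : ∀ {m} (f : Fin m → ℕ) {c} → (∀ b → f b ≤ c) → sum f ≤ m * c
sum-≤ {zero} f _ = z≤n
sum-≤ {suc m} f f≤ = +-mono-≤ (f≤ zero) (sum-≤ (λ b → f (suc b)) (λ b → f≤ (suc b)))

sum-≤-except : ∀ {m} (f : Fin m → ℕ) j {c e} → (∀ b → b ≢ j → f b ≤ c) → f j ≤ c + e → sum f ≤ e + m * c
sum-≤-except {suc m} f zero {c} {e} f≤ fj≤ = begin
  f zero + sum (λ b → f (suc b)) ≤⟨ +-mono-≤ fj≤ (sum-≤ (λ b → f (suc b)) (λ b → f≤ (suc b) λ ())) ⟩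
  c + e + m * c                   ≡⟨ cong (_+ m * c) (+-comm c e) ⟩
  e + c + m * c                   ≡⟨ +-assoc e c (m * c) ⟩
  e + (c + m * c)                 ∎
  where open ≤-Reasoning
sum-≤-except {suc m} f (suc j) {c} {e} f≤ fj≤ = begin
  f zero + sum (λ b → f (suc b))
    ≤⟨ +-mono-≤ (f≤ zero λ ())
         (sum-≤-except (λ b → f (suc b)) j (λ b b≢j → f≤ (suc b) λ { refl → b≢j refl }) fj≤) ⟩
  c + (e + m * c)                 ≡⟨ sym (+-assoc c e (m * c)) ⟩
  c + e + m * c                   ≡⟨ cong (_+ m * c) (+-comm c e) ⟩
  e + c + m * c                   ≡⟨ +-assoc e c (m * c) ⟩
  e + (c + m * c)                 ∎
  where open ≤-Reasoning

-- Graphs from edge lists, and certified distances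

module _ {n : ℕ} where
  open import Data.List.Membership.DecPropositional (≡-dec (_≟_ {n}) (_≟_ {n})) using (_∈?_)

  Loopless : List (Fin n × Fin n) → Set
  Loopless E = ∀ v → (v , v) ∉ E

  loopless? : ∀ E → Dec (Loopless E)
  loopless? E = all? (λ v → ¬? ((v , v) ∈? E))

  edgeAdj : List (Fin n × Fin n) → Fin n → Fin n → Bool
  edgeAdj E u v = does ((u , v) ∈? E) ∨ does ((v , u) ∈? E)

  fromEdges : (E : List (Fin n × Fin n)) → Loopless E → Graph n
  fromEdges E loopless = record
    { adj = edgeAdj E
    ; adj-sym = λ u v → Bool.∨-comm (does ((u , v) ∈? E)) (does ((v , u) ∈? E))
    ; irrefl = λ v → cong₂ _∨_ (dec-false ((v , v) ∈? E) (loopless v)) (dec-false ((v , v) ∈? E) (loopless v))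
    }

  edgeAdj-mono : ∀ {E E′} → (∀ {e} → e ∈ E → e ∈ E′) → ∀ u v → edgeAdj E u v ≡ true → edgeAdj E′ u v ≡ true
  edgeAdj-mono {E} {E′} E⊆E′ u v uv with (u , v) ∈? E | (v , u) ∈? E
  ... | yes uv∈ | _ = cong (_∨ does ((v , u) ∈? E′)) (dec-true ((u , v) ∈? E′) (E⊆E′ uv∈))
  ... | no _ | yes vu∈ =
    trans (cong (does ((u , v) ∈? E′) ∨_) (dec-true ((v , u) ∈? E′) (E⊆E′ vu∈))) (Bool.∨-zeroʳ _)
  edgeAdj-mono E⊆E′ u v () | no _ | no _

-- Lipschitz along edges and realised by walks, dist is the graph distance.
record Distance {n} (G : Graph n) : Set where
  field
    dist : Fin n → Fin n → ℕ
    dist-self : ∀ u → dist u u ≡ 0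
    dist-lipschitz : ∀ t → Lipschitz G (dist t)
    dist-descent : ∀ u v → u ≢ v → ∃[ w ] (Adj G u w × suc (dist w v) ≡ dist u v)

  geodesic : ∀ u v → Σ[ w ∈ Walk G u v ] steps w ≡ dist u v
  geodesic u v = go u (<-wellFounded (dist u v))
    where
    go : ∀ u → Acc _<_ (dist u v) → Σ[ w ∈ Walk G u v ] steps w ≡ dist u v
    go u (acc smaller) with u ≟ v
    ... | yes refl = ε , sym (dist-self u)
    ... | no u≢v =
      let w , e , d≡ = dist-descent u v u≢v
          walk , walk≡ = go w (smaller (≤-reflexive d≡))
      in e ◅ walk , trans (cong suc walk≡) d≡

module RootGeodesics {h} {H : Graph (suc h)} (D : Distance H) where
  open Distance D

  GeodesicStep : Fin (suc h) → Fin (suc h) → Set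
  GeodesicStep s t = Adj H s t × suc (dist zero s) ≡ dist zero t

  infixr 5 _◃◃_

  -- q ◃ t: every geodesic from the root to t passes through q.
  data _◃_ : Fin (suc h) → Fin (suc h) → Set where
    forced : ∀ {q p} → GeodesicStep q (suc p) → (∀ s → GeodesicStep s (suc p) → s ≡ q) → q ◃ suc p
    _◃◃_ : ∀ {q t u} → q ◃ t → t ◃ u → q ◃ u

  ◃⇒< : ∀ {q t} → q ◃ t → dist zero q < dist zero t
  ◃⇒< (forced (_ , d≡) _) = ≤-reflexive d≡
  ◃⇒< (q◃t ◃◃ t◃u) = <-trans (◃⇒< q◃t) (◃⇒< t◃u)

-- Gluing copies of a rooted graph

-- Vertex 0 is the common root of the m copies; vertex suc (combine b p) is the
-- non-root vertex suc p of copy b.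
module Wedge (m h : ℕ) where

  copyOf : Fin (m * h) → Fin m
  copyOf = quotient {m} h

  positionOf : Fin (m * h) → Fin h
  positionOf = remainder {m} h

  lift : Fin m → Fin (suc h) → Fin (suc (m * h))
  lift b zero = zero
  lift b (suc p) = suc (combine b p)

  local : Fin (suc (m * h)) → Fin (suc h)
  local zero = zero
  local (suc i) = suc (positionOf i)

  sameCopy : Fin (suc (m * h)) → Fin (suc (m * h)) → Bool
  sameCopy zero v = true
  sameCopy (suc i) zero = true
  sameCopy (suc i) (suc j) = does (copyOf i ≟ copyOf j)

  copyOf-combine : ∀ (b : Fin m) (p : Fin h) → copyOf (combine b p) ≡ b
  copyOf-combine b p = cong proj₁ (remQuot-combine b p)

  positionOf-combine : ∀ (b : Fin m) (p : Fin h) → positionOf (combine b p) ≡ p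
  positionOf-combine b p = cong proj₂ (remQuot-combine b p)

  lift-split : ∀ i → suc i ≡ lift (copyOf i) (suc (positionOf i))
  lift-split i = cong suc (sym (combine-remQuot {m} h i))

  vertex-view : ∀ u → u ≡ zero ⊎ ∃₂ λ b p → u ≡ lift b (suc p)
  vertex-view zero = inj₁ refl
  vertex-view (suc i) = inj₂ (copyOf i , positionOf i , lift-split i)

  local-lift : ∀ b r → local (lift b r) ≡ r
  local-lift b zero = refl
  local-lift b (suc p) = cong suc (positionOf-combine b p)

  lift-injective : ∀ {b c p q} → lift b (suc p) ≡ lift c (suc q) → b ≡ c × p ≡ q
  lift-injective {b} {c} {p} {q} eq = combine-injective b p c q (Fin.suc-injective eq)

  lift-injectiveʳ : ∀ {b r s} → lift b r ≡ lift b s → r ≡ s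
  lift-injectiveʳ {b} {r} {s} eq = trans (sym (local-lift b r)) (trans (cong local eq) (local-lift b s))

  sameCopy-sym : ∀ u v → sameCopy u v ≡ sameCopy v u
  sameCopy-sym zero zero = refl
  sameCopy-sym zero (suc j) = refl
  sameCopy-sym (suc i) zero = refl
  sameCopy-sym (suc i) (suc j) = does-⇔ (mk⇔ sym sym) (copyOf i ≟ copyOf j) (copyOf j ≟ copyOf i)

  sameCopy-lift : ∀ b c p q → sameCopy (lift b (suc p)) (lift c (suc q)) ≡ does (b ≟ c)
  sameCopy-lift b c p q = cong₂ (λ b′ c′ → does (b′ ≟ c′)) (copyOf-combine b p) (copyOf-combine c q)

  sameCopy-same : ∀ b r s → sameCopy (lift b r) (lift b s) ≡ true
  sameCopy-same b zero s = refl
  sameCopy-same b (suc p) zero = refl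
  sameCopy-same b (suc p) (suc q) = trans (sameCopy-lift b b p q) (dec-true (b ≟ b) refl)

  wedge : Graph (suc h) → Graph (suc (m * h))
  wedge H = record
    { adj = λ u v → sameCopy u v ∧ adj H (local u) (local v)
    ; adj-sym = λ u v → cong₂ _∧_ (sameCopy-sym u v) (adj-sym H (local u) (local v))
    ; irrefl = λ v → trans (cong (sameCopy v v ∧_) (irrefl H (local v))) (Bool.∧-zeroʳ _)
    }

  wedge-mono : ∀ {T H} → Subgraph T H → Subgraph (wedge T) (wedge H)
  wedge-mono T⊆H u v e with sameCopy u v
  ... | true = T⊆H (local u) (local v) e

  module _ (H : Graph (suc h)) where

    adj-lift : ∀ b r s → adj (wedge H) (lift b r) (lift b s) ≡ adj H r s
    adj-lift b r s = cong₂ _∧_ (sameCopy-same b r s) (cong₂ (adj H) (local-lift b r) (local-lift b s))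

    adj-lift-copies : ∀ b c p q →
      adj (wedge H) (lift b (suc p)) (lift c (suc q)) ≡ does (b ≟ c) ∧ adj H (suc p) (suc q)
    adj-lift-copies b c p q =
      cong₂ _∧_ (sameCopy-lift b c p q) (cong₂ (adj H) (local-lift b (suc p)) (local-lift c (suc q)))

    copy-edge : ∀ {u v} → Adj (wedge H) u v → ∃[ b ] ∃[ r ] ∃[ s ] (u ≡ lift b r × v ≡ lift b s × Adj H r s)
    copy-edge {zero} {zero} e with trans (sym (irrefl H zero)) e
    ... | ()
    copy-edge {zero} {suc j} e = copyOf j , zero , suc (positionOf j) , refl , lift-split j , e
    copy-edge {suc i} {zero} e = copyOf i , suc (positionOf i) , zero , lift-split i , refl , e
    copy-edge {suc i} {suc j} e with copyOf i ≟ copyOf j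
    ... | yes same =
      copyOf i , suc (positionOf i) , suc (positionOf j) ,
      lift-split i , trans (lift-split j) (cong (λ b → lift b (suc (positionOf j))) (sym same)) , e
    copy-edge {suc i} {suc j} () | no _

    neighbour-in-copy : ∀ {z b p} → Adj (wedge H) z (lift b (suc p)) → ∃[ s ] (z ≡ lift b s × Adj H s (suc p))
    neighbour-in-copy e with copy-edge e
    ... | c , r , suc q , z≡ , lift≡ , e′ with lift-injective lift≡
    ...   | refl , refl = r , z≡ , e′

    lift-walk : ∀ b {r s} (w : Walk H r s) → Σ[ w′ ∈ Walk (wedge H) (lift b r) (lift b s) ] steps w′ ≡ steps w
    lift-walk b = map-walk (lift b) (λ {r} {s} e → trans (adj-lift b r s) e)

  wedge-ranked : ∀ {T : Graph (suc h)} → RankedParents T zero → RankedParents (wedge T) zero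
  wedge-ranked {T} P = record
    { rank = λ v → rank (local v)
    ; parent = parent′
    ; parent-root = refl
    ; parent-adj = parent-adj′
    ; parent-rank = parent-rank′
    ; lower-is-parent = lower-is-parent′
    }
    where
    open RankedParents P

    parent′ : Fin (suc (m * h)) → Fin (suc (m * h))
    parent′ zero = zero
    parent′ (suc i) = lift (copyOf i) (parent (suc (positionOf i)))

    parent-lift : ∀ b r → parent′ (lift b r) ≡ lift b (parent r)
    parent-lift b zero = cong (lift b) (sym parent-root)
    parent-lift b (suc p) =
      cong₂ (λ c q → lift c (parent (suc q))) (copyOf-combine b p) (positionOf-combine b p)

    parent-adj′ : ∀ u → u ≢ zero → Adj (wedge T) u (parent′ u)
    parent-adj′ u u≢0 with vertex-view u
    ... | inj₁ u≡0 = ⊥-elim (u≢0 u≡0)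
    ... | inj₂ (b , p , refl) = subst (Adj (wedge T) (lift b (suc p))) (sym (parent-lift b (suc p)))
      (trans (adj-lift T b (suc p) (parent (suc p))) (parent-adj (suc p) λ ()))

    parent-rank′ : ∀ u → u ≢ zero → rank (local (parent′ u)) < rank (local u)
    parent-rank′ u u≢0 with vertex-view u
    ... | inj₁ u≡0 = ⊥-elim (u≢0 u≡0)
    ... | inj₂ (b , p , refl) = subst₂ (λ r s → rank r < rank s)
      (sym (trans (cong local (parent-lift b (suc p))) (local-lift b (parent (suc p)))))
      (sym (local-lift b (suc p)))
      (parent-rank (suc p) λ ())

    lower-is-parent′ : ∀ {u v} → Adj (wedge T) u v → rank (local v) ≤ rank (local u) → v ≡ parent′ u
    lower-is-parent′ e lower with copy-edge T e
    ... | b , r , s , refl , refl , e′ =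
      let lower′ = subst₂ (λ s′ r′ → rank s′ ≤ rank r′) (local-lift b s) (local-lift b r) lower
      in trans (cong (lift b) (lower-is-parent e′ lower′)) (sym (parent-lift b r))

  count-wedge : (f : Fin (suc (m * h)) → Bool) →
    count f ≡ indicator (f zero) + ∑[ b < m ] count (λ p → f (lift b (suc p)))
  count-wedge f = cong (indicator (f zero) +_) (sum-combine m h (λ i → indicator (f (suc i))))

  degree-lift : ∀ H b p → degree (wedge H) (lift b (suc p)) ≡ degree H (suc p)
  degree-lift H b p = begin
    degree (wedge H) v                                                     ≡⟨ degree≡count (wedge H) v ⟩
    count (adj (wedge H) v)                                                ≡⟨ count-wedge (adj (wedge H) v) ⟩
    indicator (adj (wedge H) v zero) + ∑[ c < m ] count (adjacent-in c)
      ≡⟨ cong₂ _+_ (cong indicator (adj-lift H b (suc p) zero)) own-copy ⟩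
    indicator (adj H (suc p) zero) + count (λ q → adj H (suc p) (suc q))   ≡⟨ sym (degree≡count H (suc p)) ⟩
    degree H (suc p)                                                       ∎
    where
    open ≡-Reasoning
    v : Fin (suc (m * h))
    v = lift b (suc p)
    adjacent-in : Fin m → Fin h → Bool
    adjacent-in c q = adj (wedge H) v (lift c (suc q))
    other-copy : ∀ c → c ≢ b → count (adjacent-in c) ≡ 0
    other-copy c c≢b = trans
      (count-cong (λ q → trans (adj-lift-copies H b c p q) (cong (_∧ _) (dec-false (b ≟ c) (λ b≡c → c≢b (sym b≡c))))))
      (count-false h)
    own-copy : ∑[ c < m ] count (adjacent-in c) ≡ count (λ q → adj H (suc p) (suc q))
    own-copy = trans (sum-single _ b other-copy)
      (count-cong (λ q → trans (adj-lift-copies H b b p q) (cong (_∧ _) (dec-true (b ≟ b) refl))))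

  nonRootLeaves : Graph (suc h) → ℕ
  nonRootLeaves H = count (λ p → degree H (suc p) ≡ᵇ 1)

  leaves-wedge : ∀ H → m * nonRootLeaves H ≤ leaves (wedge H)
  leaves-wedge H = begin
    m * nonRootLeaves H                                            ≡⟨ sym (sum-const m _) ⟩
    ∑[ b < m ] nonRootLeaves H
      ≡⟨ sum-cong-≗ (λ b → count-cong (λ p → cong (_≡ᵇ 1) (sym (degree-lift H b p)))) ⟩
    ∑[ b < m ] count (λ p → degree (wedge H) (lift b (suc p)) ≡ᵇ 1) ≤⟨ m≤n+m _ _ ⟩
    _                                                 ≡⟨ sym (count-wedge (λ v → degree (wedge H) v ≡ᵇ 1)) ⟩
    count (λ v → degree (wedge H) v ≡ᵇ 1)                          ≡⟨ sym (leaves≡count (wedge H)) ⟩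
    leaves (wedge H)                                               ∎
    where open ≤-Reasoning

  OutsideCopy : Fin m → Fin (suc (m * h)) → Set
  OutsideCopy b x = ∀ p → x ≢ lift b (suc p)

  -- The root lies outside every copy; j is an arbitrary choice for it.
  home : Fin m → Fin (suc (m * h)) → Fin m
  home j zero = j
  home j (suc i) = copyOf i

  outside-home : ∀ j x b → b ≢ home j x → OutsideCopy b x
  outside-home j zero b _ p ()
  outside-home j (suc i) b b≢ p x≡ =
    b≢ (trans (sym (copyOf-combine b p)) (cong copyOf (sym (Fin.suc-injective x≡))))

  copy-dichotomy : ∀ x b → (∃[ t ] x ≡ lift b t) ⊎ OutsideCopy b x
  copy-dichotomy zero b = inj₁ (zero , refl)
  copy-dichotomy (suc i) b with copyOf i ≟ b
  ... | yes refl = inj₁ (suc (positionOf i) , lift-split i)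
  ... | no i∉b = inj₂ (λ p x≡ → i∉b (trans (cong copyOf (Fin.suc-injective x≡)) (copyOf-combine b p)))

  subset-size-by-copies : ∀ (S : Subset (suc (m * h))) x (j : Fin m) {c e} →
    (∀ b → OutsideCopy b x → count (λ p → lookup S (lift b (suc p))) ≤ c) → h ≤ c + e →
    ∣ S ∣ ≤ 1 + (e + m * c)
  subset-size-by-copies S x j {c} {e} outside-≤ h≤ = begin
    ∣ S ∣                  ≡⟨ trans (∣S∣≡count S) (count-wedge (lookup S)) ⟩
    indicator (lookup S zero) + ∑[ b < m ] count (λ p → lookup S (lift b (suc p)))
      ≤⟨ +-mono-≤ (indicator-≤ (lookup S zero))
           (sum-≤-except _ (home j x) (λ b b≢ → outside-≤ b (outside-home j x b b≢))
             (≤-trans (count-≤ _) h≤)) ⟩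
    1 + (e + m * c)        ∎
    where open ≤-Reasoning

  copy-trace : Subset (suc (m * h)) → Fin m → Subset (suc h)
  copy-trace S b = false ∷ tabulate (λ p → lookup S (lift b (suc p)))

  ∣copy-trace∣ : ∀ S b → ∣ copy-trace S b ∣ ≡ count (λ p → lookup S (lift b (suc p)))
  ∣copy-trace∣ S b =
    trans (∣S∣≡count (copy-trace S b)) (count-cong (lookup∘tabulate (λ p → lookup S (lift b (suc p)))))

  copy-trace⇒∈ : ∀ {S b p} → suc p ∈ₛ copy-trace S b → lift b (suc p) ∈ₛ S
  copy-trace⇒∈ {S} {b} {p} (there p∈) =
    lookup⇒[]= _ S (trans (sym (lookup∘tabulate (λ p → lookup S (lift b (suc p))) p)) ([]=⇒lookup p∈))

  module Geodesics (H : Graph (suc h)) (D : Distance H) where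
    open Distance D
    open RootGeodesics D

    -- The distance from x: through the root unless both vertices lie in one copy.
    potential : Fin (suc (m * h)) → Fin (suc (m * h)) → ℕ
    potential x v =
      if sameCopy x v then dist (local x) (local v) else dist (local x) zero + dist zero (local v)

    potential-self : ∀ x → potential x x ≡ 0
    potential-self zero = dist-self zero
    potential-self (suc i) with copyOf i ≟ copyOf i
    ... | yes _ = dist-self (suc (positionOf i))
    ... | no i≢i = ⊥-elim (i≢i refl)

    potential-inside : ∀ b t r → potential (lift b t) (lift b r) ≡ dist t r
    potential-inside b t r rewrite sameCopy-same b t r | local-lift b t | local-lift b r = refl

    potential-outside : ∀ {b x} → OutsideCopy b x → ∀ r →
      potential x (lift b r) ≡ dist (local x) zero + dist zero r
    potential-outside {b} {zero} _ r rewrite local-lift b r | dist-self zero = refl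
    potential-outside {b} {suc i} _ zero rewrite dist-self zero = sym (+-identityʳ _)
    potential-outside {b} {suc i} outside (suc p) with copyOf i ≟ copyOf (combine b p)
    ... | yes i∈b = ⊥-elim (outside (positionOf i) (trans (lift-split i)
            (cong (λ c → lift c (suc (positionOf i))) (trans i∈b (copyOf-combine b p)))))
    ... | no _ = cong (λ r → dist (suc (positionOf i)) zero + dist zero r) (local-lift b (suc p))

    potential-lipschitz : ∀ x → Lipschitz (wedge H) (potential x)
    potential-lipschitz x e with copy-edge H e
    ... | b , r , s , refl , refl , e′ with copy-dichotomy x b
    ...   | inj₁ (t , refl) =
      subst₂ (λ d d′ → d ≤ suc d′) (sym (potential-inside b t s)) (sym (potential-inside b t r))
        (dist-lipschitz t e′)
    ...   | inj₂ outside =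
      subst₂ (λ d d′ → d ≤ suc d′) (sym (potential-outside outside s)) (sym (potential-outside outside r))
        (≤-trans (+-monoʳ-≤ (dist (local x) zero) (dist-lipschitz zero e′)) (≤-reflexive (+-suc _ _)))

    geodesic-to-root : ∀ x → Σ[ w ∈ Walk (wedge H) x zero ] steps w ≡ dist (local x) zero
    geodesic-to-root x with vertex-view x
    ... | inj₁ refl = ε , sym (dist-self zero)
    ... | inj₂ (b , p , refl) =
      let w , w≡ = geodesic (suc p) zero
          w′ , w′≡ = lift-walk H b w
      in w′ , trans w′≡ (trans w≡ (cong (λ r → dist r zero) (sym (local-lift b (suc p)))))

    walk-from-outside : ∀ {b x} → OutsideCopy b x → ∀ r →
      Σ[ w ∈ Walk (wedge H) x (lift b r) ] steps w ≡ potential x (lift b r)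
    walk-from-outside {b} {x} outside r =
      let w₁ , w₁≡ = geodesic-to-root x
          w , w≡ = geodesic zero r
          w₂ , w₂≡ = lift-walk H b w
      in w₁ ◅◅ w₂ ,
         trans (steps-◅◅ w₁ w₂) (trans (cong₂ _+_ w₁≡ (trans w₂≡ w≡)) (sym (potential-outside outside r)))

    -- A shortest path from outside copy b into it is as long as the potential allows, so
    -- the potential grows by one at each step, and within the copy each step is a geodesic one.
    forced-on-shortest-path : ∀ {b x r P} → OutsideCopy b x → IsShortestPath (wedge H) x (lift b r) P →
      ∀ {q t} → q ◃ t → lift b t ∈ P → lift b q ∈ P
    forced-on-shortest-path {b} {x} {r} {P} outside (isPath , shortest) q◃t t∈P =
      subst (lift b _ ∈_) w≡P (forced-on-walk q◃t (subst (lift b _ ∈_) (sym w≡P) t∈P))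
      where
      w : Walk (wedge H) x (lift b r)
      w = proj₁ (path⇒walk isPath)
      w≡P : vertices w ≡ P
      w≡P = proj₂ (path⇒walk isPath)

      tight : potential x x + steps w ≤ potential x (lift b r)
      tight =
        let w′ , w′≡ = walk-from-outside outside r
            Q , isQ , Q≤ = walk⇒path w′
        in begin
          potential x x + steps w    ≡⟨ cong (_+ steps w) (potential-self x) ⟩
          steps w                    ≡⟨ cong (_∸ 1) (sym (length-vertices w)) ⟩
          pathLength (vertices w)    ≡⟨ cong pathLength w≡P ⟩
          pathLength P               ≤⟨ shortest Q isQ ⟩
          pathLength Q               ≤⟨ Q≤ ⟩
          steps w′                   ≡⟨ w′≡ ⟩
          potential x (lift b r)     ∎
        where open ≤-Reasoning

      geodesic-step : ∀ {s p} → suc (potential x (lift b s)) ≡ potential x (lift b (suc p)) →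
        suc (dist zero s) ≡ dist zero (suc p)
      geodesic-step {s} {p} eq = +-cancelˡ-≡ (dist (local x) zero) _ _ (begin
        dist (local x) zero + suc (dist zero s)  ≡⟨ +-suc _ _ ⟩
        suc (dist (local x) zero + dist zero s)  ≡⟨ cong suc (sym (potential-outside outside s)) ⟩
        suc (potential x (lift b s))            ≡⟨ eq ⟩
        potential x (lift b (suc p))            ≡⟨ potential-outside outside (suc p) ⟩
        dist (local x) zero + dist zero (suc p) ∎)
        where open ≡-Reasoning

      forced-on-walk : ∀ {q t} → q ◃ t → lift b t ∈ vertices w → lift b q ∈ vertices w
      forced-on-walk (forced {p = p} _ sole) t∈ =
        let z , z∈ , e , φ≡ =
              tight-predecessor (potential-lipschitz x) w tight t∈ (λ t≡x → outside p (sym t≡x))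
            s , z≡ , e′ = neighbour-in-copy H e
            step = geodesic-step (subst (λ z′ → suc (potential x z′) ≡ potential x (lift b (suc p))) z≡ φ≡)
        in subst (_∈ vertices w) (trans z≡ (cong (lift b) (sole s (e′ , step)))) z∈
      forced-on-walk (q◃t ◃◃ t◃u) u∈ = forced-on-walk q◃t (forced-on-walk t◃u u∈)

    outside-exclusion : ∀ {x S b q t} → IsVisibilitySet (wedge H) x S → OutsideCopy b x → q ◃ t →
      lift b t ∈ₛ S → lift b q ∉ₛ S
    outside-exclusion (_ , sees) outside q◃t t∈S q∈S =
      let P , shortest , only-target = sees _ t∈S
          q∈P = forced-on-shortest-path outside shortest q◃t (path-target∈ (proj₁ shortest))
      in <-irrefl (cong (dist zero) (lift-injectiveʳ (only-target _ q∈P q∈S))) (◃⇒< q◃t)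

-- The block

blockTreeEdges : List (Fin 6 × Fin 6)
blockTreeEdges = (0F , 1F) ∷ (0F , 4F) ∷ (4F , 3F) ∷ (3F , 2F) ∷ (3F , 5F) ∷ []

blockEdges : List (Fin 6 × Fin 6)
blockEdges = (1F , 2F) ∷ blockTreeEdges

block : Graph 6
block = fromEdges blockEdges (from-yes (loopless? blockEdges))

blockTree : Graph 6
blockTree = fromEdges blockTreeEdges (from-yes (loopless? blockTreeEdges))

blockTree⊆block : Subgraph blockTree block
blockTree⊆block = edgeAdj-mono {E = blockTreeEdges} {E′ = blockEdges} there

blockRank : Fin 6 → ℕ
blockRank = lookup (0 ∷ 1 ∷ 3 ∷ 2 ∷ 1 ∷ 3 ∷ [])

blockParent : Fin 6 → Fin 6
blockParent = lookup (0F ∷ 0F ∷ 3F ∷ 4F ∷ 0F ∷ 3F ∷ [])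

blockTree-ranked : RankedParents blockTree 0F
blockTree-ranked = record
  { rank = blockRank
  ; parent = blockParent
  ; parent-root = refl
  ; parent-adj = from-yes (all? λ u → ¬? (u ≟ 0F) →-dec (adj blockTree u (blockParent u) Bool.≟ true))
  ; parent-rank = from-yes (all? λ u → ¬? (u ≟ 0F) →-dec (blockRank (blockParent u) <? blockRank u))
  ; lower-is-parent = λ {u} {v} → from-yes (all? λ u → all? λ v →
      (adj blockTree u v Bool.≟ true) →-dec (blockRank v ≤? blockRank u →-dec (v ≟ blockParent u))) u v
  }

blockDist : Fin 6 → Fin 6 → ℕ
blockDist u v = lookup (lookup table u) v
  where
  table : Vec (Vec ℕ 6) 6
  table = (0 ∷ 1 ∷ 2 ∷ 2 ∷ 1 ∷ 3 ∷ [])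
        ∷ (1 ∷ 0 ∷ 1 ∷ 2 ∷ 2 ∷ 3 ∷ [])
        ∷ (2 ∷ 1 ∷ 0 ∷ 1 ∷ 2 ∷ 2 ∷ [])
        ∷ (2 ∷ 2 ∷ 1 ∷ 0 ∷ 1 ∷ 1 ∷ [])
        ∷ (1 ∷ 2 ∷ 2 ∷ 1 ∷ 0 ∷ 2 ∷ [])
        ∷ (3 ∷ 3 ∷ 2 ∷ 1 ∷ 2 ∷ 0 ∷ [])
        ∷ []

block-distance : Distance block
block-distance = record
  { dist = blockDist
  ; dist-self = from-yes (all? λ u → blockDist u u ℕ.≟ 0)
  ; dist-lipschitz = λ t {u} {v} → from-yes (all? λ t → all? λ u → all? λ v →
      (adj block u v Bool.≟ true) →-dec (blockDist t v ≤? suc (blockDist t u))) t u v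
  ; dist-descent = from-yes (all? λ u → all? λ v → ¬? (u ≟ v) →-dec any? λ w →
      (adj block u w Bool.≟ true) ×-dec (suc (blockDist w v) ℕ.≟ blockDist u v))
  }

open RootGeodesics block-distance

geodesic-step? : ∀ s t → Dec (GeodesicStep s t)
geodesic-step? s t = (adj block s t Bool.≟ true) ×-dec (suc (blockDist 0F s) ℕ.≟ blockDist 0F t)

sole-geodesic-step? : ∀ q t → Dec (GeodesicStep q t × ∀ s → GeodesicStep s t → s ≡ q)
sole-geodesic-step? q t = geodesic-step? q t ×-dec all? (λ s → geodesic-step? s t →-dec (s ≟ q))

1◃2 : 1F ◃ 2F
1◃2 = uncurry forced (from-yes (sole-geodesic-step? 1F 2F))

4◃3 : 4F ◃ 3F
4◃3 = uncurry forced (from-yes (sole-geodesic-step? 4F 3F))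

3◃5 : 3F ◃ 5F
3◃5 = uncurry forced (from-yes (sole-geodesic-step? 3F 5F))

RespectsForcing : Subset 6 → Set
RespectsForcing s =
  0F ∉ₛ s × (2F ∈ₛ s → 1F ∉ₛ s) × (3F ∈ₛ s → 4F ∉ₛ s) × (5F ∈ₛ s → 3F ∉ₛ s) × (5F ∈ₛ s → 4F ∉ₛ s)

respectsForcing? : ∀ s → Dec (RespectsForcing s)
respectsForcing? s =
  ¬? (0F ∈ₛ? s) ×-dec (2F ∈ₛ? s →-dec ¬? (1F ∈ₛ? s)) ×-dec (3F ∈ₛ? s →-dec ¬? (4F ∈ₛ? s)) ×-dec
  (5F ∈ₛ? s →-dec ¬? (3F ∈ₛ? s)) ×-dec (5F ∈ₛ? s →-dec ¬? (4F ∈ₛ? s))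

forcing-bound : ∀ s → RespectsForcing s → ∣ s ∣ ≤ 2
forcing-bound s respects = decidable-stable (∣ s ∣ ≤? 2) λ large →
  from-no (anySubset? λ s → respectsForcing? s ×-dec ¬? (∣ s ∣ ≤? 2)) (s , respects , large)

module _ (m : ℕ) where
  open Wedge m 5
  open Geodesics block block-distance

  outside-copy-bound : ∀ {x S b} → IsVisibilitySet (wedge block) x S → OutsideCopy b x →
    count (λ p → lookup S (lift b (suc p))) ≤ 2
  outside-copy-bound {x} {S} {b} visible outside =
    subst (_≤ 2) (∣copy-trace∣ S b) (forcing-bound (copy-trace S b)
      ((λ ()) , exclude 1◃2 , exclude 4◃3 , exclude 3◃5 , exclude (4◃3 ◃◃ 3◃5)))
    where
    exclude : ∀ {q p} → suc q ◃ suc p → suc p ∈ₛ copy-trace S b → suc q ∉ₛ copy-trace S b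
    exclude q◃p p∈ q∈ = outside-exclusion visible outside q◃p (copy-trace⇒∈ p∈) (copy-trace⇒∈ q∈)

  visibility-bound : Fin m → ∀ x S → IsVisibilitySet (wedge block) x S → ∣ S ∣ ≤ 1 + (3 + m * 2)
  visibility-bound j x S visible = subset-size-by-copies S x j (λ b → outside-copy-bound visible) (≤-refl {5})

arithmetic : ∀ k → k + (1 + (3 + (4 + k) * 2)) ≡ (4 + k) * 3
arithmetic = solve-∀

proposition2p3 : (k : ℕ) → NonZero k →
    ∃[ n ] ∃[ G ] (NonZero n × Connected {n} G ×
      ∃[ T ] (SpanningTree T G ×
        (∀ (x : Fin n) (S : Subset n) → IsVisibilitySet G x S → k + ∣ S ∣ ≤ leaves T)))
proposition2p3 k _ =
  suc (m * 5) , wedge block , _ , graph-connected , wedge blockTree , tree-spanning , few-visible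
  where
  m : ℕ
  m = 4 + k
  open Wedge m 5

  tree⊆graph : Subgraph (wedge blockTree) (wedge block)
  tree⊆graph = wedge-mono {blockTree} {block} blockTree⊆block

  tree-ranked : RankedParents (wedge blockTree) zero
  tree-ranked = wedge-ranked blockTree-ranked

  graph-connected : Connected (wedge block)
  graph-connected = subgraph-connected tree⊆graph (ranked⇒connected tree-ranked)

  tree-spanning : SpanningTree (wedge blockTree) (wedge block)
  tree-spanning = ranked⇒spanning tree-ranked {H = wedge block} tree⊆graph

  few-visible : ∀ x S → IsVisibilitySet (wedge block) x S → k + ∣ S ∣ ≤ leaves (wedge blockTree)
  few-visible x S visible = begin
    k + ∣ S ∣                   ≤⟨ +-monoʳ-≤ k (visibility-bound m zero x S visible) ⟩
    k + (1 + (3 + m * 2))       ≡⟨ arithmetic k ⟩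
    m * nonRootLeaves blockTree ≤⟨ leaves-wedge blockTree ⟩
    leaves (wedge blockTree)    ∎
    where open ≤-Reasoning
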